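{- Let $X$ be a finite nonempty set of keys, $\Sigma$ a set, $q\ge1$ and $m\ge0$ integers, $\mathcal{H}=\{h_x:\Sigma\to[2^q]\}_{x\in X}$ any family of functions, and $\sigma:\{0,\dots,q-1\}\times\{0,\dots,m\}\to\Sigma$ injective. Define $\tilde f$ and FlipHash $f$ as in the context. Then $f$ is monotone: for all $x\in X$ and all $n,n'\in\{1,\dots,2^q\}$ with $n<n'$, if $f(x,n')<n$ then $f(x,n')=f(x,n)$.
   Context: $[N]=\{0,\dots,N-1\}$; $\oplus$ is bitwise XOR. For $x\in X$, $r\in\{0,\dots,q\}$: $\tilde f(x,2^r)$ is computed as $a= h_x(\sigma(0,0))\bmod 2^r$; $b=\lfloor\log_2 a\rfloor$ if $a>0$, else $b=0$; $c=h_x(\sigma(b,0))\bmod 2^b$; $\tilde f(x,2^r)=a\oplus c$. For $x\in X$ and $n\in\{1,\dots,2^q\}$, $f(x,n)\in[n]$ is computed as: let $r=\lceil\log_2 n\rceil$ and $d=\tilde f(x,2^r)$. If $d<n$, return $d$ (A). Otherwise, for $i=1,\dots,m$ in order: let $e_i=h_x(\sigma(r-1,i))\bmod 2^r$; if $e_i<2^{r-1}$, return $\tilde f(x,2^{r-1})$ (B); else if $e_i<n$, return $e_i$ (C); else continue. If the loop finishes without returning, return $\tilde f(x,2^{r-1})$ (D). -}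

module Defs where

open import Data.Nat using (ℕ; zero; suc; _+_; _*_; _∸_; _^_; _<_; _<ᵇ_; NonZero)
open import Data.Nat.DivMod using (_%_; _/_)
open import Data.Nat.Properties using (m^n≢0)
open import Data.Nat.Logarithm using (⌊log₂_⌋; ⌈log₂_⌉)
open import Data.Fin using (Fin; toℕ)
open import Data.Bool using (Bool; true; false; if_then_else_)

-- Bitwise XOR on ℕ.  xorF uses fuel; with fuel a + b both arguments have
-- been halved to 0 before the fuel runs out, so  a ⊕ b  is the true XOR.
xorF : ℕ → ℕ → ℕ → ℕ
xorF zero    a b = 0
xorF (suc k) a b =
  ((a % 2 + b % 2) % 2) + 2 * xorF k (a / 2) (b / 2)

_⊕_ : ℕ → ℕ → ℕ
a ⊕ b = xorF (a + b) a b

mod2^ : ℕ → ℕ → ℕ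
mod2^ a r = _%_ a (2 ^ r) {{m^n≢0 2 r}}

-- min(n, k) as an element of Fin (suc k).  Used only to index σ; every
-- index actually used by the algorithm is already in range, so clamping
-- is the identity on all relevant arguments.
clamp : (k : ℕ) → ℕ → Fin (suc k)
clamp zero    _       = Fin.zero
clamp (suc k) zero    = Fin.zero
clamp (suc k) (suc n) = Fin.suc (clamp k n)

module FlipHash
  {Sig : Set} (q' m : ℕ)
  (g : Sig → Fin (2 ^ suc q'))            -- g = h_x for the fixed key x
  (σ : Fin (suc q') → Fin (suc m) → Sig)
  where

  q : ℕ
  q = suc q'

  hσ : ℕ → ℕ → ℕ
  hσ i j = toℕ (g (σ (clamp q' i) (clamp m j)))

  -- f̃(x, 2^r)
  ftilde : ℕ → ℕ
  ftilde r =
    let a = mod2^ (hσ 0 0) r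
        b = ⌊log₂ a ⌋            -- ⌊log₂ 0⌋ = 0 in the stdlib, matching b = 0 for a = 0
        c = mod2^ (hσ b 0) b
    in a ⊕ c

  -- the loop over i = i₀, …, m  (fuel = number of remaining iterations)
  loop : (r n : ℕ) → (i fuel : ℕ) → ℕ
  loop r n i zero       = ftilde (r ∸ 1)                                 -- (D)
  loop r n i (suc fuel) =
    let e = mod2^ (hσ (r ∸ 1) i) r in
    if e <ᵇ 2 ^ (r ∸ 1) then ftilde (r ∸ 1)                              -- (B)
    else if e <ᵇ n then e                                                -- (C)
    else loop r n (suc i) fuel

  f : ℕ → ℕ
  f n =
    let r = ⌈log₂ n ⌉
        d = ftilde r
    in if d <ᵇ n then d                                                  -- (A)
       else loop r n 1 m

flipHash : {X Sig : Set} (q' m : ℕ) (h : X → Sig → Fin (2 ^ suc q'))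
           (σ : Fin (suc q') → Fin (suc m) → Sig) → X → ℕ → ℕ
flipHash q' m h σ x = FlipHash.f q' m (h x) σ

-- f̃(x, 2^(t+1)) and f̃(x, 2^t) are computed from h mod 2^(t+1) and h mod 2^t, which
-- differ only in bit t.  Xoring with c < 2^⌊log₂ a⌋ never clears the top bit of a, so
-- f̃(x, 2^(t+1)) < 2^t forces that bit to be 0, and then f̃(x, 2^(t+1)) = f̃(x, 2^t).
-- Iterating, a value of f̃(x, 2^r) below 2^s equals f̃(x, 2^s).
-- Now let f(x, n′) < n < n′.  If ⌈log₂ n⌉ = ⌈log₂ n′⌉ the two runs take the same
-- branches, since every returned value below n also passes the tests against n.
-- Otherwise, with r′ = ⌈log₂ n′⌉, f(x, n′) < n ≤ 2^(r′-1), so it was not returned by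
-- branch (C); in every other branch it equals f̃(x, 2^(r′-1)), hence f̃(x, 2^⌈log₂ n⌉),
-- which branch (A) returns for n.
module Submission where

open import Defs
open import Data.Nat using (ℕ; zero; suc; _+_; _*_; _∸_; _^_; _≤_; _<_; _≤′_; _<ᵇ_; z≤n; s≤s; ≤′-refl; ≤′-step; ⌊_/2⌋; ⌈_/2⌉)
open import Data.Nat.Properties
open import Data.Nat.DivMod using (_%_; _/_; m%n<n; m<n⇒m%n≡m; m∣n⇒o%n%m≡o%m; m*n/n≡m; /-monoˡ-≤; m<n*o⇒m/o<n)
open import Data.Nat.Divisibility using (n∣m*n)
open import Data.Nat.Logarithm using (⌊log₂_⌋; ⌈log₂_⌉; ⌈log₂⌉-mono-≤)
open import Data.Nat.Logarithm.Core using (⌊log2⌋; ⌈log2⌉)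
open import Data.Nat.Induction using (<-wellFounded)
open import Induction.WellFounded using (Acc; acc)
open import Data.Fin using (Fin)
open import Data.Bool using (true; false; T; if_then_else_)
open import Data.Unit using (tt)
open import Data.Product using (_×_)
open import Data.Sum using (inj₁; inj₂)
open import Relation.Nullary using (¬_; yes; no; contradiction)
open import Relation.Binary.PropositionalEquality using (_≡_; refl; sym; trans; cong; subst; module ≡-Reasoning)

<ᵇ≡true⇒< : ∀ {a b} → (a <ᵇ b) ≡ true → a < b
<ᵇ≡true⇒< {a} {b} eq = <ᵇ⇒< a b (subst T (sym eq) tt)

<ᵇ≡false⇒≮ : ∀ {a b} → (a <ᵇ b) ≡ false → ¬ a < b
<ᵇ≡false⇒≮ eq a<b = subst T eq (<⇒<ᵇ a<b)

2*n≡n+n : ∀ n → 2 * n ≡ n + n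
2*n≡n+n n = cong (n +_) (+-identityʳ n)

n<2^n : ∀ n → n < 2 ^ n
n<2^n zero    = s≤s z≤n
n<2^n (suc n) = subst (suc (suc n) ≤_) (sym (2*n≡n+n (2 ^ n))) (+-mono-≤ (m^n>0 2 n) (n<2^n n))

mod2^<2^ : ∀ a r → mod2^ a r < 2 ^ r
mod2^<2^ a r = m%n<n a (2 ^ r) {{m^n≢0 2 r}}

mod2^-suc-< : ∀ a t → mod2^ a (suc t) < 2 ^ t → mod2^ a (suc t) ≡ mod2^ a t
mod2^-suc-< a t small = trans (sym (m<n⇒m%n≡m {{m^n≢0 2 t}} small))
  (m∣n⇒o%n%m≡o%m (2 ^ t) (2 ^ suc t) a {{m^n≢0 2 t}} {{m^n≢0 2 (suc t)}} (n∣m*n 2))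

⌈n/2⌉+⌈n/2⌉≥n : ∀ n → n ≤ ⌈ n /2⌉ + ⌈ n /2⌉
⌈n/2⌉+⌈n/2⌉≥n n = ≤-trans (≤-reflexive (sym (⌊n/2⌋+⌈n/2⌉≡n n)))
  (+-monoˡ-≤ ⌈ n /2⌉ (⌊n/2⌋≤⌈n/2⌉ n))

⌊n/2⌋+⌊n/2⌋≤n : ∀ n → ⌊ n /2⌋ + ⌊ n /2⌋ ≤ n
⌊n/2⌋+⌊n/2⌋≤n n = ≤-trans (+-monoʳ-≤ ⌊ n /2⌋ (⌊n/2⌋≤⌈n/2⌉ n))
  (≤-reflexive (⌊n/2⌋+⌈n/2⌉≡n n))

2*[1+n]≡2+[n+n] : ∀ n → 2 * suc n ≡ suc (suc (n + n))
2*[1+n]≡2+[n+n] n = trans (2*n≡n+n (suc n)) (cong suc (+-suc n n))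

n≤2^⌈log2⌉n : ∀ n (rec : Acc _<_ n) → n ≤ 2 ^ ⌈log2⌉ n rec
n≤2^⌈log2⌉n zero          _         = z≤n
n≤2^⌈log2⌉n (suc zero)    _         = s≤s z≤n
n≤2^⌈log2⌉n (suc (suc n)) (acc rec) = ≤-trans 2+n≤2*[1+⌈n/2⌉]
  (*-monoʳ-≤ 2 (n≤2^⌈log2⌉n (suc ⌈ n /2⌉) (rec (⌈n/2⌉<n n))))
  where
  2+n≤2*[1+⌈n/2⌉] : suc (suc n) ≤ 2 * suc ⌈ n /2⌉
  2+n≤2*[1+⌈n/2⌉] = subst (suc (suc n) ≤_) (sym (2*[1+n]≡2+[n+n] ⌈ n /2⌉))
                      (s≤s (s≤s (⌈n/2⌉+⌈n/2⌉≥n n)))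

n≤2^⌈log₂n⌉ : ∀ n → n ≤ 2 ^ ⌈log₂ n ⌉
n≤2^⌈log₂n⌉ n = n≤2^⌈log2⌉n n (<-wellFounded n)

<2^[1+t]⇒⌊log2⌋≤t : ∀ n (rec : Acc _<_ n) t → n < 2 ^ suc t → ⌊log2⌋ n rec ≤ t
<2^[1+t]⇒⌊log2⌋≤t zero          _         t       _ = z≤n
<2^[1+t]⇒⌊log2⌋≤t (suc zero)    _         t       _ = z≤n
<2^[1+t]⇒⌊log2⌋≤t (suc (suc n)) (acc rec) zero    (s≤s (s≤s ()))
<2^[1+t]⇒⌊log2⌋≤t (suc (suc n)) (acc rec) (suc t) n<2^[2+t] =
  s≤s (<2^[1+t]⇒⌊log2⌋≤t (suc ⌊ n /2⌋) (rec (⌊n/2⌋<n (suc n))) t 1+⌊n/2⌋<2^[1+t])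
  where
  1+⌊n/2⌋<2^[1+t] : suc ⌊ n /2⌋ < 2 ^ suc t
  1+⌊n/2⌋<2^[1+t] = *-cancelˡ-< 2 (suc ⌊ n /2⌋) (2 ^ suc t)
    (subst (_< 2 * 2 ^ suc t) (sym (2*[1+n]≡2+[n+n] ⌊ n /2⌋))
      (≤-trans (s≤s (s≤s (s≤s (⌊n/2⌋+⌊n/2⌋≤n n)))) n<2^[2+t]))

<2^[1+t]⇒⌊log₂⌋≤t : ∀ {n} t → n < 2 ^ suc t → ⌊log₂ n ⌋ ≤ t
<2^[1+t]⇒⌊log₂⌋≤t {n} = <2^[1+t]⇒⌊log2⌋≤t n (<-wellFounded n)

-- With fuel k ≤ t, xorF would be cut off before it reaches bit t.
xorF-topBit : ∀ t k {a c} → t < k → 2 ^ t ≤ a → a < 2 ^ suc t → c < 2 ^ t → 2 ^ t ≤ xorF k a c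
xorF-topBit zero (suc k) {suc zero}    {zero}  _ _ _ _ = s≤s z≤n
xorF-topBit zero (suc k) {suc (suc a)} {c}     _ _ (s≤s (s≤s ())) _
xorF-topBit zero (suc k) {suc zero}    {suc c} _ _ _ (s≤s ())
xorF-topBit (suc t) (suc k) {a} {c} (s≤s t<k) 2^[1+t]≤a a<2^[2+t] c<2^[1+t] =
  ≤-trans (*-monoʳ-≤ 2 (xorF-topBit t k t<k 2^t≤a/2 a/2<2^[1+t] c/2<2^t))
          (m≤n+m _ ((a % 2 + c % 2) % 2))
  where
  2^t≤a/2 : 2 ^ t ≤ a / 2
  2^t≤a/2 = ≤-trans (≤-reflexive (sym (m*n/n≡m (2 ^ t) 2)))
              (/-monoˡ-≤ 2 (subst (_≤ a) (*-comm 2 (2 ^ t)) 2^[1+t]≤a))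
  a/2<2^[1+t] : a / 2 < 2 ^ suc t
  a/2<2^[1+t] = m<n*o⇒m/o<n (subst (a <_) (*-comm 2 (2 ^ suc t)) a<2^[2+t])
  c/2<2^t : c / 2 < 2 ^ t
  c/2<2^t = m<n*o⇒m/o<n (subst (c <_) (*-comm 2 (2 ^ t)) c<2^[1+t])

⊕-topBit : ∀ t {a c} → 2 ^ t ≤ a → a < 2 ^ suc t → c < 2 ^ t → 2 ^ t ≤ a ⊕ c
⊕-topBit t {a} {c} 2^t≤a =
  xorF-topBit t (a + c) (≤-trans (n<2^n t) (≤-trans 2^t≤a (m≤m+n a c))) 2^t≤a

module Monotonicity {Sig : Set} (q' m : ℕ) (g : Sig → Fin (2 ^ suc q'))
                    (σ : Fin (suc q') → Fin (suc m) → Sig) where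
  open FlipHash q' m g σ

  flip : ℕ → ℕ
  flip a = a ⊕ mod2^ (hσ ⌊log₂ a ⌋ 0) ⌊log₂ a ⌋

  ftilde-suc-< : ∀ t → ftilde (suc t) < 2 ^ t → ftilde (suc t) ≡ ftilde t
  ftilde-suc-< t ftilde<2^t with 2 ^ t ≤? mod2^ (hσ 0 0) (suc t)
  ... | no  a≱2^t = cong flip (mod2^-suc-< (hσ 0 0) t (≰⇒> a≱2^t))
  ... | yes 2^t≤a = contradiction ftilde<2^t
        (≤⇒≯ (⊕-topBit t 2^t≤a (mod2^<2^ (hσ 0 0) (suc t)) c<2^t))
    where
    b = ⌊log₂ mod2^ (hσ 0 0) (suc t) ⌋
    c<2^t : mod2^ (hσ b 0) b < 2 ^ t
    c<2^t = ≤-trans (mod2^<2^ (hσ b 0) b)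
              (^-monoʳ-≤ 2 (<2^[1+t]⇒⌊log₂⌋≤t t (mod2^<2^ (hσ 0 0) (suc t))))

  ftilde-stable′ : ∀ {s r} → s ≤′ r → ftilde r < 2 ^ s → ftilde r ≡ ftilde s
  ftilde-stable′ ≤′-refl _ = refl
  ftilde-stable′ {s} (≤′-step {r} s≤r) ftilde<2^s =
    trans step (ftilde-stable′ s≤r (subst (_< 2 ^ s) step ftilde<2^s))
    where
    step : ftilde (suc r) ≡ ftilde r
    step = ftilde-suc-< r (≤-trans ftilde<2^s (^-monoʳ-≤ 2 (≤′⇒≤ s≤r)))

  ftilde-stable : ∀ {s r} → s ≤ r → ftilde r < 2 ^ s → ftilde r ≡ ftilde s
  ftilde-stable s≤r = ftilde-stable′ (≤⇒≤′ s≤r)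

  loop-cong-< : ∀ r {n n′} i k → n ≤ n′ → loop r n′ i k < n → loop r n′ i k ≡ loop r n i k
  loop-cong-< r i zero    _    _ = refl
  loop-cong-< r {n} {n′} i (suc k) n≤n′ out<n with mod2^ (hσ (r ∸ 1) i) r <ᵇ 2 ^ (r ∸ 1)
  ... | true  = refl
  ... | false with mod2^ (hσ (r ∸ 1) i) r <ᵇ n′ in e<n′ | mod2^ (hσ (r ∸ 1) i) r <ᵇ n in e<n
  ...   | true  | true  = refl
  ...   | true  | false = contradiction out<n (<ᵇ≡false⇒≮ e<n)
  ...   | false | true  = contradiction (≤-trans (<ᵇ≡true⇒< e<n) n≤n′) (<ᵇ≡false⇒≮ e<n′)
  ...   | false | false = loop-cong-< r (suc i) k n≤n′ out<n

  -- Branch (C) only returns values ≥ 2^(r-1); all other exits return f̃(x, 2^(r-1)).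
  loop-small : ∀ r n i k → loop r n i k < 2 ^ (r ∸ 1) → loop r n i k ≡ ftilde (r ∸ 1)
  loop-small r n i zero    _ = refl
  loop-small r n i (suc k) out<2^[r-1] with mod2^ (hσ (r ∸ 1) i) r <ᵇ 2 ^ (r ∸ 1) in e<2^[r-1]
  ... | true  = refl
  ... | false with mod2^ (hσ (r ∸ 1) i) r <ᵇ n
  ...   | true  = contradiction out<2^[r-1] (<ᵇ≡false⇒≮ e<2^[r-1])
  ...   | false = loop-small r n (suc i) k out<2^[r-1]

  -- f with r = ⌈log₂ n⌉ abstracted, so that f n is definitionally fAt ⌈log₂ n⌉ n.
  fAt : ℕ → ℕ → ℕ
  fAt r n = if ftilde r <ᵇ n then ftilde r else loop r n 1 m

  fAt-cong-< : ∀ r {n n′} → n < n′ → fAt r n′ < n → fAt r n′ ≡ fAt r n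
  fAt-cong-< r {n} {n′} n<n′ out<n with ftilde r <ᵇ n′ in e<n′ | ftilde r <ᵇ n in e<n
  ... | true  | true  = refl
  ... | true  | false = contradiction out<n (<ᵇ≡false⇒≮ e<n)
  ... | false | true  = contradiction (<-trans (<ᵇ≡true⇒< e<n) n<n′) (<ᵇ≡false⇒≮ e<n′)
  ... | false | false = loop-cong-< r 1 m (<⇒≤ n<n′) out<n

  fAt-small : ∀ r n → fAt r n < 2 ^ (r ∸ 1) → fAt r n ≡ ftilde (r ∸ 1)
  fAt-small r n out<2^[r-1] with ftilde r <ᵇ n
  fAt-small zero    n out<2^[r-1] | true  = refl
  fAt-small (suc t) n out<2^[r-1] | true  = ftilde-suc-< t out<2^[r-1]
  ...                             | false = loop-small r n 1 m out<2^[r-1]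

  fAt-ftilde : ∀ r n → ftilde r < n → fAt r n ≡ ftilde r
  fAt-ftilde r n ftilde<n with ftilde r <ᵇ n in e<n
  ... | true  = refl
  ... | false = contradiction ftilde<n (<ᵇ≡false⇒≮ e<n)

  f-monotone : ∀ {n n′} → n < n′ → f n′ < n → f n′ ≡ f n
  f-monotone {n} {n′} n<n′ out<n with m≤n⇒m<n∨m≡n (⌈log₂⌉-mono-≤ (<⇒≤ n<n′))
  ... | inj₂ r≡r′ = trans (fAt-cong-< ⌈log₂ n′ ⌉ n<n′ out<n) (cong (λ r → fAt r n) (sym r≡r′))
  ... | inj₁ r<r′ = begin
    f n′               ≡⟨ f[n′]≡ftilde[r′-1] ⟩
    ftilde (r′ ∸ 1)    ≡⟨ ftilde[r′-1]≡ftilde[r] ⟩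
    ftilde r           ≡⟨ fAt-ftilde r n (subst (_< n) f[n′]≡ftilde[r] out<n) ⟨
    f n                ∎
    where
    open ≡-Reasoning
    r = ⌈log₂ n ⌉
    r′ = ⌈log₂ n′ ⌉
    r≤r′-1 : r ≤ r′ ∸ 1
    r≤r′-1 = <⇒≤pred r<r′
    out<2^r : f n′ < 2 ^ r
    out<2^r = ≤-trans out<n (n≤2^⌈log₂n⌉ n)
    f[n′]≡ftilde[r′-1] : f n′ ≡ ftilde (r′ ∸ 1)
    f[n′]≡ftilde[r′-1] = fAt-small r′ n′ (≤-trans out<2^r (^-monoʳ-≤ 2 r≤r′-1))
    ftilde[r′-1]≡ftilde[r] : ftilde (r′ ∸ 1) ≡ ftilde r
    ftilde[r′-1]≡ftilde[r] = ftilde-stable r≤r′-1 (subst (_< 2 ^ r) f[n′]≡ftilde[r′-1] out<2^r)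
    f[n′]≡ftilde[r] : f n′ ≡ ftilde r
    f[n′]≡ftilde[r] = trans f[n′]≡ftilde[r′-1] ftilde[r′-1]≡ftilde[r]

theorem2p4 : (k : ℕ) (Sig : Set) (q' m : ℕ)
    → (h : Fin (suc k) → Sig → Fin (2 ^ suc q'))
    → (σ : Fin (suc q') → Fin (suc m) → Sig)
    → (∀ i j i₁ j₁ → σ i j ≡ σ i₁ j₁ → (i ≡ i₁) × (j ≡ j₁))
    → (x : Fin (suc k)) (n n′ : ℕ)
    → 1 ≤ n → n′ ≤ 2 ^ suc q' → n < n′
    → flipHash q' m h σ x n′ < n
    → flipHash q' m h σ x n′ ≡ flipHash q' m h σ x n
theorem2p4 k Sig q' m h σ _ x n n′ _ _ = Monotonicity.f-monotone q' m (h x) σ
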